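{- Let $\Gamma$ be an inner ultrahomogeneous group such that either $\operatorname{Age}(\Gamma)$ has disjoint amalgamation, or, more generally, for every finitely generated subgroup $A\leq\Gamma$ and every $b\in\Gamma\setminus A$ the orbit of $b$ under $\operatorname{Aut}(\Gamma/A)$ is infinite. Then for every finite $A_0\subseteq\Gamma$ we have $C^2(A_0)=\langle A_0\rangle$. In particular, $\langle A_0\rangle$ is a definable subset of $\Gamma$, and for each $n$ the family of $n$-generated subgroups of $\Gamma$ is uniformly definable.
   Context: Conjugation is written $g^h=h^{ -1}gh$. A finite partial automorphism of a group $G$ is an isomorphism between two finitely generated subgroups of $G$. A group $\Gamma$ is inner ultrahomogeneous if for every finite partial automorphism $p$ of $\Gamma$ there is some $g\in\Gamma$ such that $a^g=p(a)$ for all $a\in\operatorname{dom}p$. $\operatorname{Age}(\Gamma)$ is the class of finitely generated groups embeddable in $\Gamma$; it has disjoint amalgamation if for all $A,B,C$ in it and embeddings $C\to A$, $C\to B$, there is $D$ in it and embeddings $A\to D$, $B\to D$ agreeing on $C$ such that the intersection of the images of $A$ and $B$ is exactly the image of $C$. $C(X)$ is the centraliser of $X$ and $C^2(X)=C(C(X))$. $\operatorname{Aut}(\Gamma/A)$ is the group of automorphisms fixing $A$ pointwise. -}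

module Defs where

open import Level using (Level; _⊔_; suc; Lift)
open import Algebra.Bundles using (Group)
open import Algebra.Morphism.Structures using (module GroupMorphisms)
open import Data.List using (List; tabulate)
open import Data.List.Membership.Propositional using (_∈_)
open import Data.List.Relation.Unary.Any using (Any)
open import Data.Nat using (ℕ)
open import Data.Fin using (Fin)
open import Data.Vec.Functional using (_∷_)
open import Data.Product using (Σ; ∃; _×_)
open import Data.Sum using (_⊎_)
open import Data.Empty using (⊥)
open import Relation.Nullary using (¬_)
open import Function.Bundles using (_⇔_)

private variable c ℓ : Level

module _ (G : Group c ℓ) where
  open Group G
  open GroupMorphisms rawGroup rawGroup

  data _∈⟨_⟩ (x : Carrier) (gs : List Carrier) : Set (c ⊔ ℓ) where
    gen  : ∀ {g} → g ∈ gs → x ≈ g → x ∈⟨ gs ⟩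
    unit : x ≈ ε → x ∈⟨ gs ⟩
    mul  : ∀ {y z} → y ∈⟨ gs ⟩ → z ∈⟨ gs ⟩ → x ≈ y ∙ z → x ∈⟨ gs ⟩
    inv  : ∀ {y} → y ∈⟨ gs ⟩ → x ≈ y ⁻¹ → x ∈⟨ gs ⟩

  _^_ : Carrier → Carrier → Carrier
  g ^ h = (h ⁻¹ ∙ g) ∙ h

  Cent : ∀ {p} → (Carrier → Set p) → Carrier → Set (c ⊔ ℓ ⊔ p)
  Cent X y = ∀ a → X a → a ∙ y ≈ y ∙ a

  Cent² : ∀ {p} → (Carrier → Set p) → Carrier → Set (c ⊔ ℓ ⊔ p)
  Cent² X = Cent (Cent X)

  record PartialAut : Set (c ⊔ ℓ) where
    field
      dom cod : List Carrier
      f       : (x : Carrier) → x ∈⟨ dom ⟩ → Carrier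
      f-cong  : ∀ {x y} (p : x ∈⟨ dom ⟩) (q : y ∈⟨ dom ⟩) → x ≈ y → f x p ≈ f y q
      f-into  : ∀ {x} (p : x ∈⟨ dom ⟩) → f x p ∈⟨ cod ⟩
      f-hom   : ∀ {x y} (p : x ∈⟨ dom ⟩) (q : y ∈⟨ dom ⟩) (r : (x ∙ y) ∈⟨ dom ⟩) →
                f (x ∙ y) r ≈ f x p ∙ f y q
      f-inj   : ∀ {x y} (p : x ∈⟨ dom ⟩) (q : y ∈⟨ dom ⟩) → f x p ≈ f y q → x ≈ y
      f-surj  : ∀ {z} → z ∈⟨ cod ⟩ → Σ Carrier λ x → Σ (x ∈⟨ dom ⟩) λ p → f x p ≈ z

  InnerUltrahomogeneous : Set (c ⊔ ℓ)
  InnerUltrahomogeneous = (p : PartialAut) → Σ Carrier λ g →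
    ∀ a (h : a ∈⟨ PartialAut.dom p ⟩) → (a ^ g) ≈ PartialAut.f p a h

  record AutOver (as : List Carrier) : Set (c ⊔ ℓ) where
    field
      σ     : Carrier → Carrier
      isAut : IsGroupIsomorphism σ
      fixes : ∀ a → a ∈⟨ as ⟩ → σ a ≈ a

  Orbit : List Carrier → Carrier → Carrier → Set (c ⊔ ℓ)
  Orbit as b y = Σ (AutOver as) λ s → AutOver.σ s b ≈ y

  FiniteSet : (Carrier → Set (c ⊔ ℓ)) → Set (c ⊔ ℓ)
  FiniteSet P = Σ (List Carrier) λ L → ∀ y → P y → Any (y ≈_) L

  InfiniteSet : (Carrier → Set (c ⊔ ℓ)) → Set (c ⊔ ℓ)
  InfiniteSet P = ¬ FiniteSet P

  InfiniteOrbits : Set (c ⊔ ℓ)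
  InfiniteOrbits = ∀ (as : List Carrier) (b : Carrier) → ¬ (b ∈⟨ as ⟩) →
    InfiniteSet (Orbit as b)

Embedding : ∀ {c₁ ℓ₁ c₂ ℓ₂} (A : Group c₁ ℓ₁) (B : Group c₂ ℓ₂) → Set (c₁ ⊔ ℓ₁ ⊔ c₂ ⊔ ℓ₂)
Embedding A B = Σ (Group.Carrier A → Group.Carrier B) λ f →
  GroupMorphisms.IsGroupMonomorphism (Group.rawGroup A) (Group.rawGroup B) f

FinitelyGenerated : Group c ℓ → Set (c ⊔ ℓ)
FinitelyGenerated A = Σ (List (Group.Carrier A)) λ gs → ∀ x → _∈⟨_⟩ A x gs

-- A ∈ Age(Γ): A finitely generated and embeddable in Γ
-- (Age(Γ) is taken at the universe levels of Γ)
InAge : (Γ : Group c ℓ) → Group c ℓ → Set (c ⊔ ℓ)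
InAge Γ A = FinitelyGenerated A × Embedding A Γ

DisjointAmalgamation : (Γ : Group c ℓ) → Set (suc (c ⊔ ℓ))
DisjointAmalgamation {c} {ℓ} Γ =
  (A B C : Group c ℓ) → InAge Γ A → InAge Γ B → InAge Γ C →
  (f : Embedding C A) (g : Embedding C B) →
  Σ (Group c ℓ) λ D → InAge Γ D × Σ (Embedding A D) λ i → Σ (Embedding B D) λ j →
    (∀ x → Group._≈_ D (Data.Product.proj₁ i (Data.Product.proj₁ f x))
                        (Data.Product.proj₁ j (Data.Product.proj₁ g x)))
    × (∀ a b → Group._≈_ D (Data.Product.proj₁ i a) (Data.Product.proj₁ j b) →
         Σ (Group.Carrier C) λ x → Group._≈_ A (Data.Product.proj₁ f x) a
                                 × Group._≈_ B (Data.Product.proj₁ g x) b)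
  where import Data.Product

data Term (n : ℕ) : Set where
  var  : Fin n → Term n
  e    : Term n
  _·_  : Term n → Term n → Term n
  inv  : Term n → Term n

data Formula : ℕ → Set where
  _==_  : ∀ {n} → Term n → Term n → Formula n
  ff    : ∀ {n} → Formula n
  _∧_ _∨_ _⇒_ : ∀ {n} → Formula n → Formula n → Formula n
  ∀' ∃' : ∀ {n} → Formula (Data.Nat.suc n) → Formula n

module Sem (G : Group c ℓ) where
  open Group G
  evalT : ∀ {n} → (Fin n → Carrier) → Term n → Carrier
  evalT ρ (var i) = ρ i
  evalT ρ e = ε
  evalT ρ (s · t) = evalT ρ s ∙ evalT ρ t
  evalT ρ (inv t) = evalT ρ t ⁻¹

  ⟦_⟧ : ∀ {n} → Formula n → (Fin n → Carrier) → Set (c ⊔ ℓ)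
  ⟦ s == t ⟧ ρ = Lift c (evalT ρ s ≈ evalT ρ t)
  ⟦ ff ⟧ ρ = Lift (c ⊔ ℓ) ⊥
  ⟦ φ ∧ ψ ⟧ ρ = ⟦ φ ⟧ ρ × ⟦ ψ ⟧ ρ
  ⟦ φ ∨ ψ ⟧ ρ = ⟦ φ ⟧ ρ ⊎ ⟦ ψ ⟧ ρ
  ⟦ φ ⇒ ψ ⟧ ρ = ⟦ φ ⟧ ρ → ⟦ ψ ⟧ ρ
  ⟦ ∀' φ ⟧ ρ = (x : Carrier) → ⟦ φ ⟧ (x ∷ ρ)
  ⟦ ∃' φ ⟧ ρ = Σ Carrier λ x → ⟦ φ ⟧ (x ∷ ρ)

  Definable : (Carrier → Set (c ⊔ ℓ)) → Set (c ⊔ ℓ)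
  Definable S = Σ ℕ λ k → Σ (Formula (Data.Nat.suc k)) λ φ → Σ (Fin k → Carrier) λ cs →
    ∀ x → S x ⇔ ⟦ φ ⟧ (x ∷ cs)

  UniformlyDefinable : ∀ {i} {I : Set i} → (I → Carrier → Set (c ⊔ ℓ)) → Set (c ⊔ ℓ ⊔ i)
  UniformlyDefinable {I = I} F = Σ ℕ λ k → Σ (Formula (Data.Nat.suc k)) λ φ →
      (∀ (a : I) → Σ (Fin k → Carrier) λ bs → ∀ x → F a x ⇔ ⟦ φ ⟧ (x ∷ bs))
    × (∀ (bs : Fin k → Carrier) → Σ I λ a → ∀ x → F a x ⇔ ⟦ φ ⟧ (x ∷ bs))

  NGenSubgroups : (n : ℕ) → (Fin n → Carrier) → Carrier → Set (c ⊔ ℓ)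
  NGenSubgroups n as x = _∈⟨_⟩ G x (tabulate as)

{-# OPTIONS --safe #-}
module Submission where

-- If g and h induce the same conjugation on A, then g h⁻¹ centralises A, hence commutes
-- with every b ∈ C²(A), so g and h also induce the same conjugation on b. By inner
-- ultrahomogeneity every embedding of ⟨b, A⟩ into Γ is a conjugation, so two embeddings
-- of ⟨b, A⟩ into Γ that agree on A agree on b. With infinite orbits this makes every
-- automorphism over A fix b, so b ∈ ⟨A⟩; with disjoint amalgamation, amalgamating
-- ⟨b, A⟩ with itself over ⟨A⟩ puts b into the common part ⟨A⟩. Finally C²(A) is cut out
-- by ∀y (⋀_{a ∈ A} ay = ya → xy = yx), uniformly in the parameters A.

open import Defs hiding (_∈⟨_⟩; _^_)
open import Level using (_⊔_; Lift; lift; lower)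
open import Algebra.Bundles using (Group)
open import Algebra.Morphism.Structures using (module GroupMorphisms)
import Algebra.Morphism.Construct.Composition as Composition
import Algebra.Properties.Group as GroupProperties
open import Axiom.ExcludedMiddle using (ExcludedMiddle)
open import Data.Fin using (Fin; zero; suc)
open import Data.List using (List; tabulate; lookup; length; [_])
open import Data.List.Properties using (tabulate-lookup)
open import Data.List.Membership.Propositional using (_∈_)
open import Data.List.Membership.Propositional.Properties using (∈-tabulate⁺; ∈-tabulate⁻)
open import Data.List.Relation.Unary.Any using (Any; here)
open import Data.Nat using (ℕ; zero; suc)
open import Data.Product using (_×_; _,_; proj₁; proj₂; ∃-syntax)
open import Data.Sum using (_⊎_; [_,_]′)
open import Data.Vec.Functional using (_∷_)
open import Function.Base using (_∘_)
open import Function.Bundles using (_⇔_; mk⇔; Equivalence)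
import Function.Properties.Equivalence as ⇔
open import Relation.Nullary using (¬_)
open import Relation.Nullary.Decidable using (decidable-stable)
import Relation.Binary.PropositionalEquality as ≡
import Relation.Binary.Reasoning.Setoid as SetoidReasoning

∀-tabulate : ∀ {a p} {A : Set a} {P : A → Set p} {n} {α : Fin n → A} →
  (∀ i → P (α i)) → ∀ x → x ∈ tabulate α → P x
∀-tabulate Pα x x∈ with ∈-tabulate⁻ x∈
... | i , ≡.refl = Pα i

weaken : ∀ {n} → Term n → Term (suc n)
weaken (var i) = var (suc i)
weaken e       = e
weaken (s · t) = weaken s · weaken t
weaken (inv t) = inv (weaken t)

⋀ : ∀ {m k} → (Fin k → Formula m) → Formula m
⋀ {k = zero}  F = e == e
⋀ {k = suc k} F = F zero ∧ ⋀ (F ∘ suc)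

Cent²-formula : ∀ k → Formula (suc k)
Cent²-formula k = ∀' (⋀ (λ i → (parameter i · y) == (y · parameter i)) ⇒ ((y · x) == (x · y)))
  where
  y x : Term (suc (suc k))
  y = var zero
  x = var (suc zero)
  parameter : Fin k → Term (suc (suc k))
  parameter i = var (suc (suc i))

module InnerUltrahomogeneity {c ℓ} (Γ : Group c ℓ) where
  open Group Γ
  open GroupProperties Γ using (\\-leftDividesˡ; \\-leftDividesʳ; //-rightDividesʳ; ∙-cancelˡ; ∙-cancelʳ)
  open GroupMorphisms
  open Sem Γ using (evalT; ⟦_⟧)
  open SetoidReasoning setoid

  _∈⟨_⟩ : Carrier → List Carrier → Set (c ⊔ ℓ)
  _∈⟨_⟩ = Defs._∈⟨_⟩ Γ

  _^_ : Carrier → Carrier → Carrier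
  _^_ = Defs._^_ Γ

  ∈⟨⟩-resp-≈ : ∀ {L x y} → x ≈ y → x ∈⟨ L ⟩ → y ∈⟨ L ⟩
  ∈⟨⟩-resp-≈ x≈y (gen p q)   = gen p (trans (sym x≈y) q)
  ∈⟨⟩-resp-≈ x≈y (unit q)    = unit (trans (sym x≈y) q)
  ∈⟨⟩-resp-≈ x≈y (mul p r q) = mul p r (trans (sym x≈y) q)
  ∈⟨⟩-resp-≈ x≈y (inv p q)   = inv p (trans (sym x≈y) q)

  ∈⟨⟩⇒Cent² : ∀ {L x} → x ∈⟨ L ⟩ → Cent² Γ (_∈ L) x
  ∈⟨⟩⇒Cent² {x = x} (gen {g} p q) y y∈C = begin
    y ∙ x  ≈⟨ ∙-congˡ q ⟩
    y ∙ g  ≈⟨ y∈C g p ⟨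
    g ∙ y  ≈⟨ ∙-congʳ q ⟨
    x ∙ y  ∎
  ∈⟨⟩⇒Cent² {x = x} (unit q) y y∈C = begin
    y ∙ x  ≈⟨ ∙-congˡ q ⟩
    y ∙ ε  ≈⟨ identityʳ y ⟩
    y      ≈⟨ identityˡ y ⟨
    ε ∙ y  ≈⟨ ∙-congʳ q ⟨
    x ∙ y  ∎
  ∈⟨⟩⇒Cent² {x = x} (mul {u} {v} p r q) y y∈C = begin
    y ∙ x        ≈⟨ ∙-congˡ q ⟩
    y ∙ (u ∙ v)  ≈⟨ assoc y u v ⟨
    (y ∙ u) ∙ v  ≈⟨ ∙-congʳ (∈⟨⟩⇒Cent² p y y∈C) ⟩
    (u ∙ y) ∙ v  ≈⟨ assoc u y v ⟩
    u ∙ (y ∙ v)  ≈⟨ ∙-congˡ (∈⟨⟩⇒Cent² r y y∈C) ⟩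
    u ∙ (v ∙ y)  ≈⟨ assoc u v y ⟨
    (u ∙ v) ∙ y  ≈⟨ ∙-congʳ q ⟨
    x ∙ y        ∎
  ∈⟨⟩⇒Cent² {x = x} (inv {u} p q) y y∈C = begin
    y ∙ x                    ≈⟨ ∙-congˡ q ⟩
    y ∙ u ⁻¹                 ≈⟨ \\-leftDividesʳ u (y ∙ u ⁻¹) ⟨
    u ⁻¹ ∙ (u ∙ (y ∙ u ⁻¹))  ≈⟨ ∙-congˡ (assoc u y (u ⁻¹)) ⟨
    u ⁻¹ ∙ ((u ∙ y) ∙ u ⁻¹)  ≈⟨ ∙-congˡ (∙-congʳ (∈⟨⟩⇒Cent² p y y∈C)) ⟨
    u ⁻¹ ∙ ((y ∙ u) ∙ u ⁻¹)  ≈⟨ ∙-congˡ (//-rightDividesʳ u y) ⟩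
    u ⁻¹ ∙ y                 ≈⟨ ∙-congʳ q ⟨
    x ∙ y                    ∎

  ^≈^⇔commutes : ∀ a g h → a ^ g ≈ a ^ h ⇔ a ∙ (g // h) ≈ (g // h) ∙ a
  ^≈^⇔commutes a g h = mk⇔
    (λ eq → begin
      a ∙ (g // h)          ≈⟨ left ⟨
      (g ∙ a ^ g) ∙ h ⁻¹    ≈⟨ ∙-congʳ (∙-congˡ eq) ⟩
      (g ∙ a ^ h) ∙ h ⁻¹    ≈⟨ right ⟩
      (g // h) ∙ a          ∎)
    (λ comm → ∙-cancelˡ g _ _ (∙-cancelʳ (h ⁻¹) _ _ (begin
      (g ∙ a ^ g) ∙ h ⁻¹    ≈⟨ left ⟩
      a ∙ (g // h)          ≈⟨ comm ⟩
      (g // h) ∙ a          ≈⟨ right ⟨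
      (g ∙ a ^ h) ∙ h ⁻¹    ∎)))
    where
    left : (g ∙ a ^ g) ∙ h ⁻¹ ≈ a ∙ (g // h)
    left = begin
      (g ∙ ((g ⁻¹ ∙ a) ∙ g)) ∙ h ⁻¹  ≈⟨ ∙-congʳ (assoc g (g ⁻¹ ∙ a) g) ⟨
      ((g ∙ (g ⁻¹ ∙ a)) ∙ g) ∙ h ⁻¹  ≈⟨ ∙-congʳ (∙-congʳ (\\-leftDividesˡ g a)) ⟩
      (a ∙ g) ∙ h ⁻¹                 ≈⟨ assoc a g (h ⁻¹) ⟩
      a ∙ (g // h)                   ∎
    right : (g ∙ a ^ h) ∙ h ⁻¹ ≈ (g // h) ∙ a
    right = begin
      (g ∙ a ^ h) ∙ h ⁻¹    ≈⟨ assoc g (a ^ h) (h ⁻¹) ⟩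
      g ∙ (a ^ h ∙ h ⁻¹)    ≈⟨ ∙-congˡ (//-rightDividesʳ h (h ⁻¹ ∙ a)) ⟩
      g ∙ (h ⁻¹ ∙ a)        ≈⟨ assoc g (h ⁻¹) a ⟨
      (g // h) ∙ a          ∎

  conjugations-agree-on-Cent² : ∀ {p} {X : Carrier → Set p} {b} → Cent² Γ X b →
    ∀ {g h} → (∀ a → X a → a ^ g ≈ a ^ h) → b ^ g ≈ b ^ h
  conjugations-agree-on-Cent² {b = b} b∈C² {g} {h} agree =
    from (^≈^⇔commutes b g h) (sym (b∈C² (g // h) g//h∈C))
    where
    open Equivalence
    g//h∈C : Cent Γ _ (g // h)
    g//h∈C a Xa = to (^≈^⇔commutes a g h) (agree a Xa)

  evalT-∈⟨⟩ : ∀ {m} (ρ : Fin m → Carrier) (t : Term m) → evalT ρ t ∈⟨ tabulate ρ ⟩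
  evalT-∈⟨⟩ ρ (var i) = gen (∈-tabulate⁺ i) refl
  evalT-∈⟨⟩ ρ e       = unit refl
  evalT-∈⟨⟩ ρ (s · t) = mul (evalT-∈⟨⟩ ρ s) (evalT-∈⟨⟩ ρ t) refl
  evalT-∈⟨⟩ ρ (inv t) = inv (evalT-∈⟨⟩ ρ t) refl

  ∈⟨⟩⇒evalT : ∀ {m} (ρ : Fin m → Carrier) {x} → x ∈⟨ tabulate ρ ⟩ → ∃[ t ] evalT ρ t ≈ x
  ∈⟨⟩⇒evalT ρ (gen p q) with ∈-tabulate⁻ p
  ... | i , ≡.refl = var i , sym q
  ∈⟨⟩⇒evalT ρ (unit q) = e , sym q
  ∈⟨⟩⇒evalT ρ (mul p r q) with ∈⟨⟩⇒evalT ρ p | ∈⟨⟩⇒evalT ρ r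
  ... | s , s≈ | t , t≈ = s · t , trans (∙-cong s≈ t≈) (sym q)
  ∈⟨⟩⇒evalT ρ (inv p q) with ∈⟨⟩⇒evalT ρ p
  ... | t , t≈ = inv t , trans (⁻¹-cong t≈) (sym q)

  evalT-weaken : ∀ {n} b (α : Fin n → Carrier) t → evalT (b ∷ α) (weaken t) ≈ evalT α t
  evalT-weaken b α (var i) = refl
  evalT-weaken b α e       = refl
  evalT-weaken b α (s · t) = ∙-cong (evalT-weaken b α s) (evalT-weaken b α t)
  evalT-weaken b α (inv t) = ⁻¹-cong (evalT-weaken b α t)

  SameEquations : ∀ {m} → (Fin m → Carrier) → (Fin m → Carrier) → Set ℓ
  SameEquations ρ ψ = ∀ s t → evalT ρ s ≈ evalT ρ t ⇔ evalT ψ s ≈ evalT ψ t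

  termPartialAut : ∀ {m} (ρ ψ : Fin m → Carrier) → SameEquations ρ ψ → PartialAut Γ
  termPartialAut {m} ρ ψ same = record
    { dom    = tabulate ρ
    ; cod    = tabulate ψ
    ; f      = λ _ p → evalT ψ (term p)
    ; f-cong = λ p q x≈y → preserves (term p) (term q)
                 (trans (term-eval p) (trans x≈y (sym (term-eval q))))
    ; f-into = λ p → evalT-∈⟨⟩ ψ (term p)
    ; f-hom  = λ p q r → preserves (term r) (term p · term q)
                 (trans (term-eval r) (sym (∙-cong (term-eval p) (term-eval q))))
    ; f-inj  = λ p q eq → trans (sym (term-eval p)) (trans (reflects (term p) (term q) eq) (term-eval q))
    ; f-surj = surjective
    }
    where
    open Equivalence
    preserves : ∀ s t → evalT ρ s ≈ evalT ρ t → evalT ψ s ≈ evalT ψ t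
    preserves s t = to (same s t)
    reflects : ∀ s t → evalT ψ s ≈ evalT ψ t → evalT ρ s ≈ evalT ρ t
    reflects s t = from (same s t)
    term : ∀ {x} → x ∈⟨ tabulate ρ ⟩ → Term m
    term p = proj₁ (∈⟨⟩⇒evalT ρ p)
    term-eval : ∀ {x} (p : x ∈⟨ tabulate ρ ⟩) → evalT ρ (term p) ≈ x
    term-eval p = proj₂ (∈⟨⟩⇒evalT ρ p)
    surjective : ∀ {z} → z ∈⟨ tabulate ψ ⟩ → ∃[ x ] ∃[ p ] evalT ψ (term {x} p) ≈ z
    surjective z∈ with ∈⟨⟩⇒evalT ψ z∈
    ... | t , t≈z = evalT ρ t , evalT-∈⟨⟩ ρ t ,
                    trans (preserves (term (evalT-∈⟨⟩ ρ t)) t (term-eval (evalT-∈⟨⟩ ρ t))) t≈z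

  conjugator : InnerUltrahomogeneous Γ → ∀ {m} {ρ ψ : Fin m → Carrier} →
    SameEquations ρ ψ → ∃[ g ] ∀ i → ρ i ^ g ≈ ψ i
  conjugator iu {ρ = ρ} {ψ} same with iu (termPartialAut ρ ψ same)
  ... | g , g-conj = g , λ i →
    let (t , t≈ρi) = ∈⟨⟩⇒evalT ρ (evalT-∈⟨⟩ ρ (var i))
    in trans (g-conj (ρ i) (evalT-∈⟨⟩ ρ (var i))) (Equivalence.to (same t (var i)) t≈ρi)

  -- ⟨ρ⟩ presented as terms modulo the equations ρ satisfies in Γ: unlike the subgroup
  -- of Γ itself, its carrier lives in Set c, as membership in Age(Γ) requires.
  module TermGroup {m} (ρ : Fin m → Carrier) where
    group : Group c ℓ
    group = record
      { Carrier = Lift c (Term m)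
      ; _≈_     = λ s t → evalT ρ (lower s) ≈ evalT ρ (lower t)
      ; _∙_     = λ s t → lift (lower s · lower t)
      ; ε       = lift e
      ; _⁻¹     = λ s → lift (inv (lower s))
      ; isGroup = record
        { isMonoid = record
          { isSemigroup = record
            { isMagma = record
              { isEquivalence = record { refl = refl ; sym = sym ; trans = trans }
              ; ∙-cong        = ∙-cong
              }
            ; assoc = λ _ _ _ → assoc _ _ _
            }
          ; identity = (λ _ → identityˡ _) , (λ _ → identityʳ _)
          }
        ; inverse = (λ _ → inverseˡ _) , (λ _ → inverseʳ _)
        ; ⁻¹-cong = ⁻¹-cong
        }
      }

    IsEmbedding : (Lift c (Term m) → Carrier) → Set (c ⊔ ℓ)
    IsEmbedding = IsGroupMonomorphism (Group.rawGroup group) rawGroup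

    generated : FinitelyGenerated group
    generated = tabulate (lift ∘ var) , generates ∘ lower
      where
      generates : (t : Term m) → Defs._∈⟨_⟩ group (lift t) (tabulate (lift ∘ var))
      generates (var i) = gen (∈-tabulate⁺ i) refl
      generates e       = unit refl
      generates (s · t) = mul (generates s) (generates t) refl
      generates (inv t) = inv (generates t) refl

    embedding : Embedding group Γ
    embedding = evalT ρ ∘ lower , record
      { isGroupHomomorphism = record
        { isMonoidHomomorphism = record
          { isMagmaHomomorphism = record
            { isRelHomomorphism = record { cong = λ eq → eq }
            ; homo              = λ _ _ → refl
            }
          ; ε-homo = refl
          }
        ; ⁻¹-homo = λ _ → refl
        }
      ; injective = λ eq → eq
      }

    inAge : InAge Γ group
    inAge = generated , embedding

    module _ {h} (h-hom : IsGroupHomomorphism (Group.rawGroup group) rawGroup h) where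
      open IsGroupHomomorphism h-hom

      evalT-generators : ∀ t → evalT (h ∘ lift ∘ var) t ≈ h (lift t)
      evalT-generators (var i) = refl
      evalT-generators e       = sym ε-homo
      evalT-generators (s · t) = trans (∙-cong (evalT-generators s) (evalT-generators t)) (sym (homo _ _))
      evalT-generators (inv t) = trans (⁻¹-cong (evalT-generators t)) (sym (⁻¹-homo _))

    embedding-sameEquations : ∀ {h} → IsEmbedding h → SameEquations ρ (h ∘ lift ∘ var)
    embedding-sameEquations {h} h-mono s t = mk⇔
      (λ eq → begin
        evalT (h ∘ lift ∘ var) s  ≈⟨ evalT-generators isGroupHomomorphism s ⟩
        h (lift s)                ≈⟨ ⟦⟧-cong eq ⟩
        h (lift t)                ≈⟨ evalT-generators isGroupHomomorphism t ⟨
        evalT (h ∘ lift ∘ var) t  ∎)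
      (λ eq → injective (begin
        h (lift s)                ≈⟨ evalT-generators isGroupHomomorphism s ⟨
        evalT (h ∘ lift ∘ var) s  ≈⟨ eq ⟩
        evalT (h ∘ lift ∘ var) t  ≈⟨ evalT-generators isGroupHomomorphism t ⟩
        h (lift t)                ∎))
      where open IsGroupMonomorphism h-mono

  weakening : ∀ {n} b (α : Fin n → Carrier) →
    Embedding (TermGroup.group α) (TermGroup.group (b ∷ α))
  weakening b α = lift ∘ weaken ∘ lower , record
    { isGroupHomomorphism = record
      { isMonoidHomomorphism = record
        { isMagmaHomomorphism = record
          { isRelHomomorphism = record
            { cong = λ {s} {t} eq →
                trans (evalT-weaken b α (lower s)) (trans eq (sym (evalT-weaken b α (lower t))))
            }
          ; homo = λ _ _ → refl
          }
        ; ε-homo = refl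
        }
      ; ⁻¹-homo = λ _ → refl
      }
    ; injective = λ {s} {t} eq →
        trans (sym (evalT-weaken b α (lower s))) (trans eq (evalT-weaken b α (lower t)))
    }

  embeddings-agree-on-Cent² : InnerUltrahomogeneous Γ → ∀ {n} (α : Fin n → Carrier) {b} →
    Cent² Γ (_∈ tabulate α) b → ∀ {h₁ h₂} →
    TermGroup.IsEmbedding (b ∷ α) h₁ → TermGroup.IsEmbedding (b ∷ α) h₂ →
    (∀ k → h₁ (lift (var (suc k))) ≈ h₂ (lift (var (suc k)))) →
    h₁ (lift (var zero)) ≈ h₂ (lift (var zero))
  embeddings-agree-on-Cent² iu α {b} b∈C² {h₁} {h₂} h₁-mono h₂-mono agree-on-α
    with conjugator iu (TermGroup.embedding-sameEquations (b ∷ α) h₁-mono)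
       | conjugator iu (TermGroup.embedding-sameEquations (b ∷ α) h₂-mono)
  ... | g₁ , g₁-conj | g₂ , g₂-conj = begin
    h₁ (lift (var zero))  ≈⟨ g₁-conj zero ⟨
    b ^ g₁                ≈⟨ conjugations-agree-on-Cent² b∈C² (∀-tabulate λ k → begin
                               α k ^ g₁                   ≈⟨ g₁-conj (suc k) ⟩
                               h₁ (lift (var (suc k)))    ≈⟨ agree-on-α k ⟩
                               h₂ (lift (var (suc k)))    ≈⟨ g₂-conj (suc k) ⟨
                               α k ^ g₂                   ∎) ⟩
    b ^ g₂                ≈⟨ g₂-conj zero ⟩
    h₂ (lift (var zero))  ∎

  AutOver-fixes-Cent² : InnerUltrahomogeneous Γ → ∀ {n} (α : Fin n → Carrier) {b} →
    Cent² Γ (_∈ tabulate α) b → (s : AutOver Γ (tabulate α)) → AutOver.σ s b ≈ b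
  AutOver-fixes-Cent² iu α {b} b∈C² s = sym (embeddings-agree-on-Cent² iu α b∈C²
    inclusion-mono (Composition.isGroupMonomorphism trans inclusion-mono σ-mono)
    (λ k → sym (fixes (α k) (evalT-∈⟨⟩ α (var k)))))
    where
    open AutOver s
    inclusion-mono : TermGroup.IsEmbedding (b ∷ α) (evalT (b ∷ α) ∘ lower)
    inclusion-mono = proj₂ (TermGroup.embedding (b ∷ α))
    σ-mono : IsGroupMonomorphism rawGroup rawGroup σ
    σ-mono = IsGroupIsomorphism.isGroupMonomorphism isAut

  infiniteOrbits⇒Cent²⊆⟨⟩ : InnerUltrahomogeneous Γ → InfiniteOrbits Γ →
    ∀ {n} (α : Fin n → Carrier) {b} → Cent² Γ (_∈ tabulate α) b → ¬ ¬ b ∈⟨ tabulate α ⟩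
  infiniteOrbits⇒Cent²⊆⟨⟩ iu io α {b} b∈C² b∉ = io (tabulate α) b b∉ ([ b ] , orbit⊆[b])
    where
    orbit⊆[b] : ∀ y → Orbit Γ (tabulate α) b y → Any (y ≈_) [ b ]
    orbit⊆[b] y (s , σb≈y) = here (trans (sym σb≈y) (AutOver-fixes-Cent² iu α b∈C² s))

  disjointAmalgamation⇒Cent²⊆⟨⟩ : InnerUltrahomogeneous Γ → DisjointAmalgamation Γ →
    ∀ {n} (α : Fin n → Carrier) {b} → Cent² Γ (_∈ tabulate α) b → b ∈⟨ tabulate α ⟩
  disjointAmalgamation⇒Cent²⊆⟨⟩ iu da α {b} b∈C²
    with da (TermGroup.group (b ∷ α)) (TermGroup.group (b ∷ α)) (TermGroup.group α)
            (TermGroup.inAge (b ∷ α)) (TermGroup.inAge (b ∷ α)) (TermGroup.inAge α)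
            (weakening b α) (weakening b α)
  ... | D , (_ , (_ , D↪Γ-mono)) , (i , i-mono) , (j , j-mono) , i≈j-on-α , disjoint
    with disjoint (lift (var zero)) (lift (var zero)) i≈j-on-b
    where
    module D↪Γ = IsGroupMonomorphism D↪Γ-mono
    i≈j-on-b : Group._≈_ D (i (lift (var zero))) (j (lift (var zero)))
    i≈j-on-b = D↪Γ.injective (embeddings-agree-on-Cent² iu α b∈C²
      (Composition.isGroupMonomorphism trans i-mono D↪Γ-mono)
      (Composition.isGroupMonomorphism trans j-mono D↪Γ-mono)
      (λ k → D↪Γ.⟦⟧-cong (i≈j-on-α (lift (var k)))))
  ... | lift t , wt≈b , _ = ∈⟨⟩-resp-≈ (trans (sym (evalT-weaken b α t)) wt≈b) (evalT-∈⟨⟩ α t)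

  ⟦⋀⟧ : ∀ {m k} (F : Fin k → Formula m) (ρ : Fin m → Carrier) → ⟦ ⋀ F ⟧ ρ ⇔ (∀ i → ⟦ F i ⟧ ρ)
  ⟦⋀⟧ {k = zero}  F ρ = mk⇔ (λ _ ()) (λ _ → lift refl)
  ⟦⋀⟧ {k = suc k} F ρ = mk⇔
    (λ { (F₀ , F₊) zero → F₀ ; (F₀ , F₊) (suc i) → to (⟦⋀⟧ (F ∘ suc) ρ) F₊ i })
    (λ H → H zero , from (⟦⋀⟧ (F ∘ suc) ρ) (H ∘ suc))
    where open Equivalence

  ⟦Cent²-formula⟧ : ∀ {k} (cs : Fin k → Carrier) x →
    ⟦ Cent²-formula k ⟧ (x ∷ cs) ⇔ Cent² Γ (_∈ tabulate cs) x
  ⟦Cent²-formula⟧ cs x = mk⇔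
    (λ sat y y∈C → lower (sat y (from (⟦⋀⟧ _ _) λ i → lift (y∈C (cs i) (∈-tabulate⁺ i)))))
    (λ x∈C² y y∈C → lift (x∈C² y (∀-tabulate λ i → lower (to (⟦⋀⟧ _ _) y∈C i))))
    where open Equivalence

  module Consequences (em : ExcludedMiddle (c ⊔ ℓ)) (iu : InnerUltrahomogeneous Γ)
                      (hyp : DisjointAmalgamation Γ ⊎ InfiniteOrbits Γ) where

    Cent²⊆⟨⟩ : ∀ {n} (α : Fin n → Carrier) {x} → Cent² Γ (_∈ tabulate α) x → x ∈⟨ tabulate α ⟩
    Cent²⊆⟨⟩ α x∈C² =
      [ (λ da → disjointAmalgamation⇒Cent²⊆⟨⟩ iu da α x∈C²)
      , (λ io → decidable-stable em (infiniteOrbits⇒Cent²⊆⟨⟩ iu io α x∈C²))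
      ]′ hyp

    Cent²⇔∈⟨⟩ : ∀ (L : List Carrier) x → Cent² Γ (_∈ L) x ⇔ x ∈⟨ L ⟩
    Cent²⇔∈⟨⟩ L x = ≡.subst (λ L′ → Cent² Γ (_∈ L′) x ⇔ x ∈⟨ L′ ⟩) (tabulate-lookup L)
                            (mk⇔ (Cent²⊆⟨⟩ (lookup L)) ∈⟨⟩⇒Cent²)

    ∈⟨⟩⇔Cent²-formula : ∀ {k} (cs : Fin k → Carrier) x →
      x ∈⟨ tabulate cs ⟩ ⇔ ⟦ Cent²-formula k ⟧ (x ∷ cs)
    ∈⟨⟩⇔Cent²-formula cs x =
      ⇔.trans (mk⇔ ∈⟨⟩⇒Cent² (Cent²⊆⟨⟩ cs)) (⇔.sym (⟦Cent²-formula⟧ cs x))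

    ⟨⟩-definable : ∀ (L : List Carrier) → Sem.Definable Γ (_∈⟨ L ⟩)
    ⟨⟩-definable L = length L , Cent²-formula (length L) , lookup L , λ x →
      ≡.subst (λ L′ → x ∈⟨ L′ ⟩ ⇔ ⟦ Cent²-formula (length L) ⟧ (x ∷ lookup L))
              (tabulate-lookup L)
              (∈⟨⟩⇔Cent²-formula (lookup L) x)

    n-generated-uniformly-definable : ∀ n → Sem.UniformlyDefinable Γ (Sem.NGenSubgroups Γ n)
    n-generated-uniformly-definable n =
      n , Cent²-formula n , (λ as → as , ∈⟨⟩⇔Cent²-formula as)
                          , (λ as → as , ∈⟨⟩⇔Cent²-formula as)

open Defs using (_∈⟨_⟩)

proposition4p33 : ∀ {c ℓ} → ExcludedMiddle (c ⊔ ℓ) → (Γ : Group c ℓ) →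
    InnerUltrahomogeneous Γ →
    (DisjointAmalgamation Γ ⊎ InfiniteOrbits Γ) →
    ((A₀ : List (Group.Carrier Γ)) → (x : Group.Carrier Γ) →
        Cent² Γ (λ a → a ∈ A₀) x ⇔ _∈⟨_⟩ Γ x A₀)
    × ((A₀ : List (Group.Carrier Γ)) → Sem.Definable Γ (λ x → _∈⟨_⟩ Γ x A₀))
    × ((n : ℕ) → Sem.UniformlyDefinable Γ (Sem.NGenSubgroups Γ n))
proposition4p33 em Γ iu hyp = Cent²⇔∈⟨⟩ , ⟨⟩-definable , n-generated-uniformly-definable
  where open InnerUltrahomogeneity.Consequences Γ em iu hyp
          using (Cent²⇔∈⟨⟩; ⟨⟩-definable; n-generated-uniformly-definable)
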